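{- Let $\mathfrak{Ba}$ be the countable atomless Boolean algebra with universe $B$, regarded as a Boolean ring. Let $G$ be a closed subgroup of $\mathrm{Sym}(B)$ with $\mathrm{Aut}(\mathfrak{Ba})\le G\le \mathrm{Sym}(B)$. If every element of $G$ preserves some non-linear binary term function $f(x,y)$ of $\mathfrak{Ba}$, then $G=\mathrm{Aut}(\mathfrak{Ba})$.
   Context: $\mathfrak{Ba}$ is viewed as a Boolean ring $(B,+,\cdot,0,1)$ with $+$ symmetric difference and $\cdot$ meet. Every binary term function can be written uniquely as a sum of monomials from $\{1,x,y,xy\}$ with coefficients in $\{0,1\}$; it is non-linear if the monomial $xy$ occurs. A permutation $\varphi$ of $B$ preserves $f$ if $\varphi(f(a,b))=f(\varphi(a),\varphi(b))$ for all $a,b\in B$. $\mathrm{Sym}(B)$ carries the topology of pointwise convergence ($B$ discrete); "closed" refers to this topology. -}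

module Defs where

open import Level using (Level; 0ℓ)
open import Data.Bool using (Bool; true; false; if_then_else_)
open import Data.Nat using (ℕ)
open import Data.List using (List)
open import Data.List.Membership.Propositional using (_∈_)
open import Data.Product using (Σ; ∃; ∃-syntax; _×_; _,_)
open import Function using (id)
open import Function.Bundles using (_↔_; Inverse)
open import Function.Construct.Identity using (↔-id)
open import Function.Construct.Composition using (_↔-∘_)
open import Function.Construct.Symmetry using (↔-sym)
open import Relation.Binary.PropositionalEquality using (_≡_)
open import Relation.Nullary using (¬_)
open import Algebra.Structures using (IsCommutativeRing)

-- Additive inverse is the
-- identity (x + x = 0 in a Boolean ring), so we record the ring with - = id.
record BooleanRing : Set₁ where
  infixl 6 _+_
  infixl 7 _·_
  field
    Carrier : Set
    _+_ : Carrier → Carrier → Carrier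
    _·_ : Carrier → Carrier → Carrier
    0# : Carrier
    1# : Carrier
    isCommutativeRing : IsCommutativeRing _≡_ _+_ _·_ id 0# 1#
    ·-idem : ∀ x → x · x ≡ x

module _ (R : BooleanRing) where
  open BooleanRing R

  _≤B_ : Carrier → Carrier → Set
  b ≤B a = b · a ≡ b

  Atomless : Set
  Atomless = ¬ (0# ≡ 1#) ×
    (∀ a → ¬ (a ≡ 0#) → ∃[ b ] (b ≤B a × ¬ (b ≡ 0#) × ¬ (b ≡ a)))

  Countable : Set
  Countable = Carrier ↔ ℕ

  Perm : Set
  Perm = Carrier ↔ Carrier

  IsAut : Perm → Set
  IsAut φ = (∀ x y → to (x + y) ≡ to x + to y)
          × (∀ x y → to (x · y) ≡ to x · to y)
          × (to 0# ≡ 0#) × (to 1# ≡ 1#)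
    where open Inverse φ

  _⊙_ : Bool → Carrier → Carrier
  c ⊙ x = if c then x else 0#

  termFun : Bool → Bool → Bool → Bool → Carrier → Carrier → Carrier
  termFun c₁ cx cy cxy x y = c₁ ⊙ 1# + cx ⊙ x + cy ⊙ y + cxy ⊙ (x · y)

  -- binary term function given by its coefficient vector (c₁, cₓ, c_y, c_xy)
  record TermFun : Set where
    constructor mkTerm
    field
      c₁ cx cy cxy : Bool

  evalTerm : TermFun → Carrier → Carrier → Carrier
  evalTerm (mkTerm c₁ cx cy cxy) = termFun c₁ cx cy cxy

  NonLinear : TermFun → Set
  NonLinear t = TermFun.cxy t ≡ true

  Preserves : Perm → (Carrier → Carrier → Carrier) → Set
  Preserves φ f = ∀ a b → to (f a b) ≡ f (to a) (to b)
    where open Inverse φ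

  IsSubgroup : (Perm → Set) → Set
  IsSubgroup G = G (↔-id Carrier)
               × (∀ g h → G g → G h → G (g ↔-∘ h))
               × (∀ g → G g → G (↔-sym g))

  -- G is closed in the topology of pointwise convergence (B discrete):
  -- any permutation that agrees on each finite set with some member of G
  -- belongs to G
  IsClosed : (Perm → Set) → Set
  IsClosed G = ∀ φ → (∀ (F : List Carrier) → ∃[ g ] (G g ×
                  (∀ x → x ∈ F → Inverse.to g x ≡ Inverse.to φ x))) → G φ

-- The inclusion G ⊆ Aut(Ba) holds for a purely algebraic reason, valid in
-- every Boolean ring: a permutation preserving a non-linear binary term
-- function is a ring automorphism.
--
--  * Every non-linear term has the shape f(x,y) = c + cₓx + c_y y + xy, and
--      f(a,b) = f(a,a)  iff  a ≤ b  (when c_y = 0),  resp.  b ≤ a  (c_y = 1),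
--    so the Boolean order is definable from f by an equation.
--  * A permutation preserving f preserves this equation in both directions
--    (it is injective), hence is an order isomorphism.
--  * An order isomorphism preserves meets and joins (glb/lub), hence 0, 1 and
--    complements, hence x + y = (x ∨ y)(1 + xy): it is a ring automorphism.

module Submission where

open import Defs
open import Data.Bool using (Bool; true; false)
open import Data.Product using (∃-syntax; _×_; _,_)
open import Function.Bundles using (Inverse; Injection; _⇔_; mk⇔; Equivalence)
open import Function.Construct.Composition using (_⇔-∘_)
open import Function.Construct.Symmetry using (⇔-sym)
open import Relation.Binary.PropositionalEquality
open import Function.Properties.Inverse using (↔⇒↣)
open import Algebra.Structures using (IsCommutativeRing)

module BooleanRingTheory (R : BooleanRing) where
  open BooleanRing R
  open IsCommutativeRing isCommutativeRing
    using (+-assoc; +-comm; +-identityˡ; +-identityʳ; -‿inverseʳ;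
           *-assoc; *-comm; *-identityˡ; *-identityʳ; distribˡ; distribʳ;
           zeroˡ; zeroʳ)
  open ≡-Reasoning

  infix 4 _≤_
  _≤_ : Carrier → Carrier → Set
  _≤_ = _≤B_ R

  ≡-resp-⇔ : ∀ {a a′ b b′ : Carrier} → a ≡ a′ → b ≡ b′ → (a ≡ b) ⇔ (a′ ≡ b′)
  ≡-resp-⇔ refl refl = mk⇔ (λ e → e) (λ e → e)

  x+x≡0 : ∀ x → x + x ≡ 0#
  x+x≡0 = -‿inverseʳ

  +-involutive : ∀ k a → k + (k + a) ≡ a
  +-involutive k a = begin
    k + (k + a) ≡⟨ +-assoc k k a ⟨
    (k + k) + a ≡⟨ cong (_+ a) (x+x≡0 k) ⟩
    0# + a      ≡⟨ +-identityˡ a ⟩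
    a           ∎

  +-cancelˡ : ∀ k {a b} → k + a ≡ k + b → a ≡ b
  +-cancelˡ k {a} {b} e =
    trans (sym (+-involutive k a)) (trans (cong (k +_) e) (+-involutive k b))

  +-cancelˡ-⇔ : ∀ k {a b} → (k + a ≡ k + b) ⇔ (a ≡ b)
  +-cancelˡ-⇔ k = mk⇔ (+-cancelˡ k) (cong (k +_))

  +≡0⇔≡ : ∀ {a b} → (a + b ≡ 0#) ⇔ (a ≡ b)
  +≡0⇔≡ {a} {b} = mk⇔
    (λ e → sym (trans (sym (+-involutive a b)) (trans (cong (a +_) e) (+-identityʳ a))))
    (λ { refl → x+x≡0 a })

  ≤-antisym : ∀ {x y} → x ≤ y → y ≤ x → x ≡ y
  ≤-antisym {x} {y} p q = trans (sym p) (trans (*-comm x y) q)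

  ≤-trans : ∀ {x y z} → x ≤ y → y ≤ z → x ≤ z
  ≤-trans {x} {y} {z} p q = begin
    x · z       ≡⟨ cong (_· z) p ⟨
    x · y · z   ≡⟨ *-assoc x y z ⟩
    x · (y · z) ≡⟨ cong (x ·_) q ⟩
    x · y       ≡⟨ p ⟩
    x           ∎

  ·-lowerʳ : ∀ x y → x · y ≤ y
  ·-lowerʳ x y = trans (*-assoc x y y) (cong (x ·_) (·-idem y))

  ·-lowerˡ : ∀ x y → x · y ≤ x
  ·-lowerˡ x y = subst (_≤ x) (*-comm y x) (·-lowerʳ y x)

  ·-absorb : ∀ x y → x · (x · y) ≡ x · y
  ·-absorb x y = trans (sym (*-assoc x x y)) (cong (_· y) (·-idem x))

  ·-greatest : ∀ {z x y} → z ≤ x → z ≤ y → z ≤ x · y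
  ·-greatest {z} {x} {y} p q = trans (sym (*-assoc z x y)) (trans (cong (_· y) p) q)

  infixl 6 _∨_
  _∨_ : Carrier → Carrier → Carrier
  x ∨ y = x + y + x · y

  ∨-comm : ∀ x y → x ∨ y ≡ y ∨ x
  ∨-comm x y = cong₂ _+_ (+-comm x y) (*-comm x y)

  ∨-upperˡ : ∀ x y → x ≤ x ∨ y
  ∨-upperˡ x y = begin
    x · (x + y + x · y)       ≡⟨ distribˡ x (x + y) (x · y) ⟩
    x · (x + y) + x · (x · y) ≡⟨ cong₂ _+_ (distribˡ x x y) (·-absorb x y) ⟩
    x · x + x · y + x · y     ≡⟨ +-assoc (x · x) (x · y) (x · y) ⟩
    x · x + (x · y + x · y)   ≡⟨ cong₂ _+_ (·-idem x) (x+x≡0 (x · y)) ⟩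
    x + 0#                    ≡⟨ +-identityʳ x ⟩
    x                         ∎

  ∨-upperʳ : ∀ x y → y ≤ x ∨ y
  ∨-upperʳ x y = subst (y ≤_) (∨-comm y x) (∨-upperˡ y x)

  ∨-least : ∀ {x y u} → x ≤ u → y ≤ u → x ∨ y ≤ u
  ∨-least {x} {y} {u} p q = begin
    (x + y + x · y) · u         ≡⟨ distribʳ u (x + y) (x · y) ⟩
    (x + y) · u + x · y · u     ≡⟨ cong₂ _+_ (distribʳ u x y) (*-assoc x y u) ⟩
    x · u + y · u + x · (y · u) ≡⟨ cong₂ _+_ (cong₂ _+_ p q) (cong (x ·_) q) ⟩
    x + y + x · y               ∎

  complement-disjoint : ∀ x → x · (1# + x) ≡ 0#
  complement-disjoint x = begin
    x · (1# + x)      ≡⟨ distribˡ x 1# x ⟩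
    x · 1# + x · x    ≡⟨ cong₂ _+_ (*-identityʳ x) (·-idem x) ⟩
    x + x             ≡⟨ x+x≡0 x ⟩
    0#                ∎

  complement-covers : ∀ x → x ∨ (1# + x) ≡ 1#
  complement-covers x = begin
    x + (1# + x) + x · (1# + x) ≡⟨ cong (x + (1# + x) +_) (complement-disjoint x) ⟩
    x + (1# + x) + 0#           ≡⟨ +-identityʳ _ ⟩
    x + (1# + x)                ≡⟨ +-comm x (1# + x) ⟩
    (1# + x) + x                ≡⟨ +-assoc 1# x x ⟩
    1# + (x + x)                ≡⟨ cong (1# +_) (x+x≡0 x) ⟩
    1# + 0#                     ≡⟨ +-identityʳ 1# ⟩
    1#                          ∎

  complement-unique : ∀ {a b} → a · b ≡ 0# → a ∨ b ≡ 1# → b ≡ 1# + a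
  complement-unique {a} {b} disjoint covers = begin
    b                 ≡⟨ +-involutive a b ⟨
    a + (a + b)       ≡⟨ +-comm a (a + b) ⟩
    (a + b) + a       ≡⟨ cong (_+ a) (+-identityʳ (a + b)) ⟨
    a + b + 0# + a    ≡⟨ cong (λ z → a + b + z + a) disjoint ⟨
    a + b + a · b + a ≡⟨ cong (_+ a) covers ⟩
    1# + a            ∎

  ∨-without-meet : ∀ x y → (x ∨ y) · (1# + x · y) ≡ x + y
  ∨-without-meet x y = begin
    (x ∨ y) · (1# + x · y)          ≡⟨ distribˡ (x ∨ y) 1# (x · y) ⟩
    (x ∨ y) · 1# + (x ∨ y) · (x · y) ≡⟨ cong₂ _+_ (*-identityʳ _) meet-below-join ⟩
    x + y + x · y + x · y           ≡⟨ +-assoc (x + y) (x · y) (x · y) ⟩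
    x + y + (x · y + x · y)         ≡⟨ cong (x + y +_) (x+x≡0 (x · y)) ⟩
    x + y + 0#                      ≡⟨ +-identityʳ _ ⟩
    x + y                           ∎
    where
      meet-below-join : (x ∨ y) · (x · y) ≡ x · y
      meet-below-join =
        trans (*-comm (x ∨ y) (x · y)) (≤-trans (·-lowerˡ x y) (∨-upperˡ x y))

  IsOrderIso : Perm R → Set
  IsOrderIso g = ∀ {x y} → (x ≤ y) ⇔ (Inverse.to g x ≤ Inverse.to g y)

  module OrderIsomorphism (g : Perm R) (order-iso : IsOrderIso g) where
    open Inverse g using (to; from; strictlyInverseˡ)

    monotone : ∀ {x y} → x ≤ y → to x ≤ to y
    monotone = Equivalence.to order-iso

    reflecting : ∀ {x y} → to x ≤ to y → x ≤ y
    reflecting = Equivalence.from order-iso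

    preimage-below : ∀ {z u} → z ≤ to u → from z ≤ u
    preimage-below {z} p = reflecting (subst (_≤ _) (sym (strictlyInverseˡ z)) p)

    preimage-above : ∀ {z u} → to u ≤ z → u ≤ from z
    preimage-above {z} p = reflecting (subst (_ ≤_) (sym (strictlyInverseˡ z)) p)

    -- Meets are greatest lower bounds, so they are preserved.
    preserves-· : ∀ x y → to (x · y) ≡ to x · to y
    preserves-· x y = ≤-antisym (·-greatest (monotone (·-lowerˡ x y)) (monotone (·-lowerʳ x y)))
                                (subst (_≤ to (x · y)) (strictlyInverseˡ m) (monotone preimage-below-meet))
      where
        m : Carrier
        m = to x · to y
        preimage-below-meet : from m ≤ x · y
        preimage-below-meet = ·-greatest (preimage-below (·-lowerˡ (to x) (to y)))
                                         (preimage-below (·-lowerʳ (to x) (to y)))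

    -- Joins are least upper bounds, so they are preserved.
    preserves-∨ : ∀ x y → to (x ∨ y) ≡ to x ∨ to y
    preserves-∨ x y = ≤-antisym (subst (to (x ∨ y) ≤_) (strictlyInverseˡ j) (monotone join-below-preimage))
                                (∨-least (monotone (∨-upperˡ x y)) (monotone (∨-upperʳ x y)))
      where
        j : Carrier
        j = to x ∨ to y
        join-below-preimage : x ∨ y ≤ from j
        join-below-preimage = ∨-least (preimage-above (∨-upperˡ (to x) (to y)))
                                      (preimage-above (∨-upperʳ (to x) (to y)))

    -- 0 and 1 are absorbing resp. neutral for meets; use a preimage of each.
    preserves-0 : to 0# ≡ 0#
    preserves-0 = begin
      to 0#               ≡⟨ cong to (zeroˡ (from 0#)) ⟨
      to (0# · from 0#)   ≡⟨ preserves-· 0# (from 0#) ⟩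
      to 0# · to (from 0#) ≡⟨ cong (to 0# ·_) (strictlyInverseˡ 0#) ⟩
      to 0# · 0#          ≡⟨ zeroʳ (to 0#) ⟩
      0#                  ∎

    preserves-1 : to 1# ≡ 1#
    preserves-1 = begin
      to 1#                ≡⟨ *-identityʳ (to 1#) ⟨
      to 1# · 1#           ≡⟨ cong (to 1# ·_) (strictlyInverseˡ 1#) ⟨
      to 1# · to (from 1#) ≡⟨ preserves-· 1# (from 1#) ⟨
      to (1# · from 1#)    ≡⟨ cong to (*-identityˡ (from 1#)) ⟩
      to (from 1#)         ≡⟨ strictlyInverseˡ 1# ⟩
      1#                   ∎

    -- The image of the complement is disjoint from and covers the image.
    preserves-complement : ∀ x → to (1# + x) ≡ 1# + to x
    preserves-complement x = complement-unique
      (trans (sym (preserves-· x (1# + x))) (trans (cong to (complement-disjoint x)) preserves-0))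
      (trans (sym (preserves-∨ x (1# + x))) (trans (cong to (complement-covers x)) preserves-1))

    -- x + y = (x ∨ y)(1 + xy) is built from preserved operations.
    preserves-+ : ∀ x y → to (x + y) ≡ to x + to y
    preserves-+ x y = begin
      to (x + y)                             ≡⟨ cong to (∨-without-meet x y) ⟨
      to ((x ∨ y) · (1# + x · y))            ≡⟨ preserves-· (x ∨ y) (1# + x · y) ⟩
      to (x ∨ y) · to (1# + x · y)           ≡⟨ cong₂ _·_ (preserves-∨ x y) complement-of-meet ⟩
      (to x ∨ to y) · (1# + to x · to y)     ≡⟨ ∨-without-meet (to x) (to y) ⟩
      to x + to y                            ∎
      where
        complement-of-meet : to (1# + x · y) ≡ 1# + to x · to y
        complement-of-meet = trans (preserves-complement (x · y)) (cong (1# +_) (preserves-· x y))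

    order-iso⇒aut : IsAut R g
    order-iso⇒aut = preserves-+ , preserves-· , preserves-0 , preserves-1

  Oriented : Bool → Carrier → Carrier → Set
  Oriented false a b = a ≤ b
  Oriented true  a b = b ≤ a

  -- For f = c₁ + cₓx + c_y y + xy, the diagonal equation f(a,b) = f(a,a)
  -- says a ≤ b when c_y = 0 and b ≤ a when c_y = 1: after cancelling the
  -- common part c₁ + cₓa it reads c_y b + ab = c_y a + a.
  diagonal-equation⇔order : ∀ c₁ cx cy a b →
    (termFun R c₁ cx cy true a b ≡ termFun R c₁ cx cy true a a) ⇔ Oriented cy a b
  diagonal-equation⇔order c₁ cx cy a b =
    (remainder-equation cy ⇔-∘ +-cancelˡ-⇔ common) ⇔-∘ ≡-resp-⇔ (split b) (split a)
    where
      common : Carrier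
      common = _⊙_ R c₁ 1# + _⊙_ R cx a

      split : ∀ z → termFun R c₁ cx cy true a z ≡ common + (_⊙_ R cy z + a · z)
      split z = +-assoc common (_⊙_ R cy z) (a · z)

      remainder-equation : ∀ c → (_⊙_ R c b + a · b ≡ _⊙_ R c a + a · a) ⇔ Oriented c a b
      remainder-equation false =
        ≡-resp-⇔ (+-identityˡ (a · b)) (trans (+-identityˡ (a · a)) (·-idem a))
      remainder-equation true =
        swap-meet ⇔-∘ (+≡0⇔≡ ⇔-∘ ≡-resp-⇔ refl (trans (cong (a +_) (·-idem a)) (x+x≡0 a)))
        where
          swap-meet : (b ≡ a · b) ⇔ (b · a ≡ b)
          swap-meet = mk⇔ (λ e → trans (*-comm b a) (sym e)) (λ e → trans (sym e) (*-comm b a))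

  -- A permutation preserving f preserves its diagonal equation in both
  -- directions, the converse direction by injectivity.
  preserves-diagonal-equation : ∀ (g : Perm R) f → Preserves R g f → ∀ a b →
    (f a b ≡ f a a) ⇔ (f (Inverse.to g a) (Inverse.to g b) ≡ f (Inverse.to g a) (Inverse.to g a))
  preserves-diagonal-equation g f preserves a b = mk⇔
    (λ e → trans (sym (preserves a b)) (trans (cong to e) (preserves a a)))
    (λ e → Injection.injective (↔⇒↣ g) (trans (preserves a b) (trans e (sym (preserves a a)))))
    where open Inverse g using (to)

  oriented-preserved⇒order-iso : ∀ (g : Perm R) c →
    (∀ a b → Oriented c a b ⇔ Oriented c (Inverse.to g a) (Inverse.to g b)) → IsOrderIso g
  oriented-preserved⇒order-iso g false preserved {x} {y} = preserved x y
  oriented-preserved⇒order-iso g true  preserved {x} {y} = preserved y x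

  nonlinear-preserver⇒order-iso : ∀ (g : Perm R) t → NonLinear R t →
    Preserves R g (evalTerm R t) → IsOrderIso g
  nonlinear-preserver⇒order-iso g (mkTerm c₁ cx cy true) refl preserves =
    oriented-preserved⇒order-iso g cy λ a b →
      diagonal-equation⇔order c₁ cx cy (to a) (to b)
        ⇔-∘ (preserves-diagonal-equation g (termFun R c₁ cx cy true) preserves a b
        ⇔-∘ ⇔-sym (diagonal-equation⇔order c₁ cx cy a b))
    where open Inverse g using (to)

lemma2p1 : (R : BooleanRing) → Atomless R → Countable R →
    (G : Perm R → Set) → IsSubgroup R G → IsClosed R G →
    (∀ φ → IsAut R φ → G φ) →
    (∀ g → G g → ∃[ t ] (NonLinear R t × Preserves R g (evalTerm R t))) →
    ∀ g → G g → IsAut R g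
lemma2p1 R _ _ G _ _ _ preservesNonLinear g g∈G =
  let (t , nonlinear , preserves) = preservesNonLinear g g∈G
  in OrderIsomorphism.order-iso⇒aut g (nonlinear-preserver⇒order-iso g t nonlinear preserves)
  where open BooleanRingTheory R
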